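{- For each $v \in \{3,9,15,21,33,39,57,69\}$ there exists a rainbow Kirkman triple system of order $v$.
   Context: A Kirkman triple system KTS$(v)$ is a Steiner triple system on $v$ points (every pair of points in exactly one triple) together with a partition of its triples into parallel classes (sets of triples partitioning the point set). A $3$-colouring is a map from the points to $3$ colours such that no triple is monochromatic. A colouring of a KTS$(v)$ is rainbow if it is a $3$-colouring in which each colour class has exactly $v/3$ points and some parallel class of the resolution has every triple receiving all three colours; a KTS is rainbow if it admits a rainbow colouring. -}

module Defs where

open import Data.Nat using (ℕ; _*_)
open import Data.Fin using (Fin)
open import Data.Fin.Properties using (_≟_)
open import Data.Product using (_×_; _,_; Σ; ∃; ∃-syntax)
open import Data.Sum using (_⊎_)
open import Data.List using (List; length; filter; concat)
open import Data.List.Membership.Propositional using (_∈_)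
open import Data.List.Relation.Unary.All using (All)
open import Data.List.Relation.Unary.Any using (Any)
open import Relation.Binary.PropositionalEquality using (_≡_)
open import Relation.Nullary using (¬_; Dec)
open import Relation.Nullary.Decidable using (_⊎-dec_; _×-dec_)

Triple : ℕ → Set
Triple v = Fin v × Fin v × Fin v

_∈T_ : ∀ {v} → Fin v → Triple v → Set
x ∈T (a , b , c) = x ≡ a ⊎ x ≡ b ⊎ x ≡ c

_∈T?_ : ∀ {v} (x : Fin v) (t : Triple v) → Dec (x ∈T t)
x ∈T? (a , b , c) = (x ≟ a) ⊎-dec ((x ≟ b) ⊎-dec (x ≟ c))

Proper : ∀ {v} → Triple v → Set
Proper (a , b , c) = ¬ a ≡ b × ¬ a ≡ c × ¬ b ≡ c

countPt : ∀ {v} → Fin v → List (Triple v) → ℕ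
countPt x ts = length (filter (λ t → x ∈T? t) ts)

countPair : ∀ {v} → Fin v → Fin v → List (Triple v) → ℕ
countPair x y ts = length (filter (λ t → (x ∈T? t) ×-dec (y ∈T? t)) ts)

IsSTS : ∀ v → List (Triple v) → Set
IsSTS v ts = All Proper ts × (∀ (x y : Fin v) → ¬ x ≡ y → countPair x y ts ≡ 1)

IsParallelClass : ∀ v → List (Triple v) → Set
IsParallelClass v P = ∀ (x : Fin v) → countPt x P ≡ 1

record KTS (v : ℕ) : Set where
  field
    resolution : List (List (Triple v))
    isSTS      : IsSTS v (concat resolution)
    parallel   : All (IsParallelClass v) resolution

  triples : List (Triple v)
  triples = concat resolution

Colouring : ℕ → Set
Colouring v = Fin v → Fin 3

Monochromatic : ∀ {v} → Colouring v → Triple v → Set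
Monochromatic f (a , b , c) = f a ≡ f b × f b ≡ f c

Rainbow3 : ∀ {v} → Colouring v → Triple v → Set
Rainbow3 f (a , b , c) = ¬ f a ≡ f b × ¬ f a ≡ f c × ¬ f b ≡ f c

classSize : ∀ {v} → Colouring v → Fin 3 → ℕ
classSize {v} f i = length (filter (λ x → f x ≟ i) (Data.List.allFin v))

IsRainbowColouring : ∀ {v} → KTS v → Colouring v → Set
IsRainbowColouring {v} K f =
  All (λ t → ¬ Monochromatic f t) (KTS.triples K)
  × (∀ (i : Fin 3) → 3 * classSize f i ≡ v)
  × Any (All (Rainbow3 f)) (KTS.resolution K)

IsRainbowKTS : ∀ {v} → KTS v → Set
IsRainbowKTS {v} K = ∃[ f ] IsRainbowColouring K f

-- Each order is settled by an explicit resolution whose points are labelled so that colouring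
-- a point by its label mod 3 is a rainbow colouring, its first parallel class being rainbow.
-- Every defining condition of a rainbow KTS is decidable, so the systems are verified by
-- evaluation.

module Submission where

open import Defs
open import Data.Nat using (ℕ; suc; _*_; NonZero)
open import Data.List using (List; _∷_; []; map; filter; length; concat)
open import Data.List.Membership.Propositional using (_∈_)
open import Data.Product using (∃-syntax; _×_; _,_)
open import Data.Empty using (⊥-elim)
open import Data.Bool using (true)
open import Data.Nat.DivMod using (_mod_)
open import Data.Nat.Properties using () renaming (_≟_ to _≟ℕ_)
open import Data.Fin using (Fin; toℕ)
open import Data.Fin.Properties using (_≟_; toℕ-injective; all?)
open import Data.List.Relation.Unary.All as All using (All; _∷_; [])
open import Data.List.Relation.Unary.Any using (any?)
open import Data.Product.Function.NonDependent.Propositional using (_×-⇔_)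
open import Data.Sum using (_⊎_)
import Data.Sum as Sum
open import Function using (_∘_; _⇔_; mk⇔; Equivalence)
open import Relation.Nullary using (¬_; Dec; yes; no; does; ¬?)
open import Relation.Nullary.Decidable using (map′; _×-dec_; _⊎-dec_; _→-dec_)
open import Relation.Unary using (Pred; Decidable)
open import Relation.Binary.PropositionalEquality using (_≡_; refl; sym; trans; cong)

private
  variable
    v : ℕ

module _ {a b p q} {A : Set a} {B : Set b} {P : Pred A p} {Q : Pred B q}
         (P? : Decidable P) (Q? : Decidable Q) where

  length-filter-map : (f : A → B) → (∀ x → P x ⇔ Q (f x)) →
    ∀ xs → length (filter P? xs) ≡ length (filter Q? (map f xs))
  length-filter-map f P⇔Q [] = refl
  length-filter-map f P⇔Q (x ∷ xs) with P? x | Q? (f x)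
  ... | yes _   | yes _   = cong suc (length-filter-map f P⇔Q xs)
  ... | no  _   | no  _   = length-filter-map f P⇔Q xs
  ... | yes Px  | no ¬Qfx = ⊥-elim (¬Qfx (Equivalence.to (P⇔Q x) Px))
  ... | no ¬Px  | yes Qfx = ⊥-elim (¬Px (Equivalence.from (P⇔Q x) Qfx))

module _ {a p q} {A : Set a} {P : Pred A p} {Q : Pred A q}
         (P? : Decidable P) (Q? : Decidable Q) where

  filter-×-dec : ∀ xs → filter (λ x → P? x ×-dec Q? x) xs ≡ filter Q? (filter P? xs)
  filter-×-dec [] = refl
  filter-×-dec (x ∷ xs) with P? x
  ... | no _ = filter-×-dec xs
  ... | yes _ with Q? x
  ...   | yes _ = cong (x ∷_) (filter-×-dec xs)
  ...   | no _  = filter-×-dec xs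

Tripleℕ : Set
Tripleℕ = ℕ × ℕ × ℕ

_∈Tℕ_ : ℕ → Tripleℕ → Set
n ∈Tℕ (a , b , c) = n ≡ a ⊎ n ≡ b ⊎ n ≡ c

_∈Tℕ?_ : ∀ n t → Dec (n ∈Tℕ t)
n ∈Tℕ? (a , b , c) = (n ≟ℕ a) ⊎-dec (n ≟ℕ b) ⊎-dec (n ≟ℕ c)

toTripleℕ : Triple v → Tripleℕ
toTripleℕ (a , b , c) = toℕ a , toℕ b , toℕ c

∈T⇔∈Tℕ : (x : Fin v) (t : Triple v) → x ∈T t ⇔ toℕ x ∈Tℕ toTripleℕ t
∈T⇔∈Tℕ x (a , b , c) = mk⇔ (Sum.map (cong toℕ) (Sum.map (cong toℕ) (cong toℕ)))
                            (Sum.map toℕ-injective (Sum.map toℕ-injective toℕ-injective))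

containing : ℕ → List Tripleℕ → List Tripleℕ
containing n = filter (n ∈Tℕ?_)

countℕ : ℕ → List Tripleℕ → ℕ
countℕ n = length ∘ containing n

countPt-toℕ : (x : Fin v) (ts : List (Triple v)) →
  countPt x ts ≡ countℕ (toℕ x) (map toTripleℕ ts)
countPt-toℕ x = length-filter-map (x ∈T?_) (toℕ x ∈Tℕ?_) toTripleℕ (∈T⇔∈Tℕ x)

countPair-toℕ : (x y : Fin v) (ts : List (Triple v)) →
  countPair x y ts ≡ countℕ (toℕ y) (containing (toℕ x) (map toTripleℕ ts))
countPair-toℕ x y ts = trans
  (length-filter-map (λ t → (x ∈T? t) ×-dec (y ∈T? t)) (λ n → (toℕ x ∈Tℕ? n) ×-dec (toℕ y ∈Tℕ? n))
                     toTripleℕ (λ t → ∈T⇔∈Tℕ x t ×-⇔ ∈T⇔∈Tℕ y t) ts)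
  (cong length (filter-×-dec (toℕ x ∈Tℕ?_) (toℕ y ∈Tℕ?_) (map toTripleℕ ts)))

proper? : Decidable (Proper {v})
proper? (a , b , c) = ¬? (a ≟ b) ×-dec ¬? (a ≟ c) ×-dec ¬? (b ≟ c)

eachOnce? : (ns : List Tripleℕ) → Dec (∀ (x : Fin v) → countℕ (toℕ x) ns ≡ 1)
eachOnce? ns = all? λ x → countℕ (toℕ x) ns ≟ℕ 1

eachOtherOnce? : (x : Fin v) (ns : List Tripleℕ) → Dec (∀ y → ¬ x ≡ y → countℕ (toℕ y) ns ≡ 1)
eachOtherOnce? x ns = all? λ y → ¬? (x ≟ y) →-dec countℕ (toℕ y) ns ≟ℕ 1

-- The triples through x are passed as an argument so that they are computed once and shared
-- by all y: the check costs about v · |ns| steps instead of v² · |ns|.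
eachPairOnce? : (ns : List Tripleℕ) →
  Dec (∀ (x y : Fin v) → ¬ x ≡ y → countℕ (toℕ y) (containing (toℕ x) ns) ≡ 1)
eachPairOnce? ns = all? λ x → eachOtherOnce? x (containing (toℕ x) ns)

isParallelClass? : ∀ v (P : List (Triple v)) → Dec (IsParallelClass v P)
isParallelClass? v P = map′ (λ h x → trans (countPt-toℕ x P) (h x))
                            (λ h x → trans (sym (countPt-toℕ x P)) (h x))
                            (eachOnce? (map toTripleℕ P))

isSTS? : ∀ v (ts : List (Triple v)) → Dec (IsSTS v ts)
isSTS? v ts = All.all? proper? ts ×-dec
  map′ (λ h x y x≢y → trans (countPair-toℕ x y ts) (h x y x≢y))
       (λ h x y x≢y → trans (sym (countPair-toℕ x y ts)) (h x y x≢y))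
       (eachPairOnce? (map toTripleℕ ts))

monochromatic? : (f : Colouring v) → Decidable (Monochromatic f)
monochromatic? f (a , b , c) = (f a ≟ f b) ×-dec (f b ≟ f c)

rainbow3? : (f : Colouring v) → Decidable (Rainbow3 f)
rainbow3? f (a , b , c) = ¬? (f a ≟ f b) ×-dec ¬? (f a ≟ f c) ×-dec ¬? (f b ≟ f c)

isRainbowColouring? : (K : KTS v) (f : Colouring v) → Dec (IsRainbowColouring K f)
isRainbowColouring? {v} K f =
  All.all? (¬? ∘ monochromatic? f) (KTS.triples K) ×-dec
  all? (λ i → 3 * classSize f i ≟ℕ v) ×-dec
  any? (All.all? (rainbow3? f)) (KTS.resolution K)

-- Used with `refl` in place of `toWitness`: the conversion checker evaluates `does … ≡ true`
-- several times faster than it solves the unit meta of a `True …` argument.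
witness : ∀ {a} {A : Set a} (a? : Dec A) → does a? ≡ true → A
witness (yes a) _ = a

kirkman : (R : List (List (Triple v))) →
  does (isSTS? v (concat R)) ≡ true → does (All.all? (isParallelClass? v) R) ≡ true → KTS v
kirkman {v} R sts par = record
  { resolution = R
  ; isSTS      = witness (isSTS? v (concat R)) sts
  ; parallel   = witness (All.all? (isParallelClass? v) R) par
  }

rainbowKTS : (K : KTS v) (f : Colouring v) → does (isRainbowColouring? K f) ≡ true →
  ∃[ K ] IsRainbowKTS K
rainbowKTS K f rainbow = K , f , witness (isRainbowColouring? K f) rainbow

-- The resolutions below are written with numerals below v; `mod v` only retypes them, and
-- every check runs on the resulting triples, so no range argument is needed.
fromTripleℕ : .{{NonZero v}} → Tripleℕ → Triple v
fromTripleℕ {v} (a , b , c) = a mod v , b mod v , c mod v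

residue : Colouring v
residue x = toℕ x mod 3

resolution3 : List (List Tripleℕ)
resolution3 =
    ((0 , 1 , 2) ∷ [])
  ∷ []

resolution9 : List (List Tripleℕ)
resolution9 =
    ((2 , 1 , 3) ∷ (0 , 8 , 7) ∷ (5 , 4 , 6) ∷ [])
  ∷ ((2 , 0 , 5) ∷ (1 , 8 , 4) ∷ (3 , 7 , 6) ∷ [])
  ∷ ((2 , 8 , 6) ∷ (0 , 4 , 3) ∷ (5 , 1 , 7) ∷ [])
  ∷ ((2 , 4 , 7) ∷ (0 , 1 , 6) ∷ (5 , 8 , 3) ∷ [])
  ∷ []

resolution15 : List (List Tripleℕ)
resolution15 =
    ((2 , 4 , 3) ∷ (11 , 10 , 0) ∷ (9 , 1 , 8) ∷ (7 , 14 , 6) ∷ (5 , 13 , 12) ∷ [])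
  ∷ ((2 , 11 , 7) ∷ (13 , 6 , 3) ∷ (14 , 8 , 4) ∷ (10 , 1 , 12) ∷ (0 , 9 , 5) ∷ [])
  ∷ ((2 , 13 , 10) ∷ (9 , 12 , 7) ∷ (1 , 4 , 11) ∷ (6 , 8 , 5) ∷ (3 , 14 , 0) ∷ [])
  ∷ ((2 , 9 , 6) ∷ (14 , 5 , 10) ∷ (8 , 11 , 13) ∷ (12 , 4 , 0) ∷ (7 , 1 , 3) ∷ [])
  ∷ ((2 , 14 , 12) ∷ (1 , 0 , 6) ∷ (4 , 13 , 9) ∷ (5 , 11 , 3) ∷ (10 , 8 , 7) ∷ [])
  ∷ ((2 , 1 , 5) ∷ (8 , 3 , 12) ∷ (11 , 9 , 14) ∷ (0 , 13 , 7) ∷ (6 , 4 , 10) ∷ [])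
  ∷ ((2 , 8 , 0) ∷ (4 , 7 , 5) ∷ (13 , 14 , 1) ∷ (3 , 9 , 10) ∷ (12 , 11 , 6) ∷ [])
  ∷ []

resolution21 : List (List Tripleℕ)
resolution21 =
    ((0 , 1 , 2) ∷ (3 , 4 , 5) ∷ (6 , 7 , 8) ∷ (9 , 10 , 11) ∷ (12 , 13 , 14) ∷ (15 , 16 , 17) ∷ (18 , 19 , 20) ∷ [])
  ∷ ((9 , 7 , 16) ∷ (19 , 2 , 8) ∷ (6 , 12 , 1) ∷ (13 , 5 , 17) ∷ (0 , 3 , 11) ∷ (15 , 18 , 4) ∷ (10 , 14 , 20) ∷ [])
  ∷ ((10 , 8 , 17) ∷ (20 , 0 , 6) ∷ (7 , 13 , 2) ∷ (14 , 3 , 15) ∷ (1 , 4 , 9) ∷ (16 , 19 , 5) ∷ (11 , 12 , 18) ∷ [])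
  ∷ ((11 , 6 , 15) ∷ (18 , 1 , 7) ∷ (8 , 14 , 0) ∷ (12 , 4 , 16) ∷ (2 , 5 , 10) ∷ (17 , 20 , 3) ∷ (9 , 13 , 19) ∷ [])
  ∷ ((0 , 4 , 10) ∷ (7 , 5 , 14) ∷ (9 , 18 , 8) ∷ (19 , 11 , 17) ∷ (3 , 6 , 16) ∷ (1 , 13 , 20) ∷ (12 , 15 , 2) ∷ [])
  ∷ ((1 , 5 , 11) ∷ (8 , 3 , 12) ∷ (10 , 19 , 6) ∷ (20 , 9 , 15) ∷ (4 , 7 , 17) ∷ (2 , 14 , 18) ∷ (13 , 16 , 0) ∷ [])
  ∷ ((2 , 3 , 9) ∷ (6 , 4 , 13) ∷ (11 , 20 , 7) ∷ (18 , 10 , 16) ∷ (5 , 8 , 15) ∷ (0 , 12 , 19) ∷ (14 , 17 , 1) ∷ [])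
  ∷ ((4 , 2 , 11) ∷ (3 , 7 , 19) ∷ (6 , 9 , 14) ∷ (15 , 10 , 13) ∷ (0 , 18 , 17) ∷ (12 , 5 , 20) ∷ (1 , 16 , 8) ∷ [])
  ∷ ((5 , 0 , 9) ∷ (4 , 8 , 20) ∷ (7 , 10 , 12) ∷ (16 , 11 , 14) ∷ (1 , 19 , 15) ∷ (13 , 3 , 18) ∷ (2 , 17 , 6) ∷ [])
  ∷ ((3 , 1 , 10) ∷ (5 , 6 , 18) ∷ (8 , 11 , 13) ∷ (17 , 9 , 12) ∷ (2 , 20 , 16) ∷ (14 , 4 , 19) ∷ (0 , 15 , 7) ∷ [])
  ∷ []

resolution33 : List (List Tripleℕ)
resolution33 =
    ((0 , 1 , 2) ∷ (3 , 4 , 5) ∷ (6 , 7 , 8) ∷ (9 , 10 , 11) ∷ (12 , 13 , 14) ∷ (15 , 16 , 17) ∷ (18 , 19 , 20) ∷ (21 , 22 , 23) ∷ (24 , 25 , 26) ∷ (27 , 28 , 29) ∷ (30 , 31 , 32) ∷ [])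
  ∷ ((18 , 1 , 4) ∷ (10 , 2 , 23) ∷ (0 , 19 , 28) ∷ (22 , 31 , 14) ∷ (24 , 11 , 20) ∷ (6 , 30 , 25) ∷ (21 , 8 , 17) ∷ (12 , 27 , 26) ∷ (15 , 7 , 13) ∷ (16 , 5 , 32) ∷ (3 , 9 , 29) ∷ [])
  ∷ ((19 , 2 , 5) ∷ (11 , 0 , 21) ∷ (1 , 20 , 29) ∷ (23 , 32 , 12) ∷ (25 , 9 , 18) ∷ (7 , 31 , 26) ∷ (22 , 6 , 15) ∷ (13 , 28 , 24) ∷ (16 , 8 , 14) ∷ (17 , 3 , 30) ∷ (4 , 10 , 27) ∷ [])
  ∷ ((20 , 0 , 3) ∷ (9 , 1 , 22) ∷ (2 , 18 , 27) ∷ (21 , 30 , 13) ∷ (26 , 10 , 19) ∷ (8 , 32 , 24) ∷ (23 , 7 , 16) ∷ (14 , 29 , 25) ∷ (17 , 6 , 12) ∷ (15 , 4 , 31) ∷ (5 , 11 , 28) ∷ [])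
  ∷ ((21 , 1 , 10) ∷ (28 , 2 , 32) ∷ (0 , 22 , 16) ∷ (31 , 25 , 5) ∷ (6 , 29 , 23) ∷ (18 , 24 , 7) ∷ (30 , 20 , 14) ∷ (3 , 15 , 8) ∷ (12 , 19 , 4) ∷ (13 , 11 , 26) ∷ (9 , 27 , 17) ∷ [])
  ∷ ((22 , 2 , 11) ∷ (29 , 0 , 30) ∷ (1 , 23 , 17) ∷ (32 , 26 , 3) ∷ (7 , 27 , 21) ∷ (19 , 25 , 8) ∷ (31 , 18 , 12) ∷ (4 , 16 , 6) ∷ (13 , 20 , 5) ∷ (14 , 9 , 24) ∷ (10 , 28 , 15) ∷ [])
  ∷ ((23 , 0 , 9) ∷ (27 , 1 , 31) ∷ (2 , 21 , 15) ∷ (30 , 24 , 4) ∷ (8 , 28 , 22) ∷ (20 , 26 , 6) ∷ (32 , 19 , 13) ∷ (5 , 17 , 7) ∷ (14 , 18 , 3) ∷ (12 , 10 , 25) ∷ (11 , 29 , 16) ∷ [])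
  ∷ ((6 , 1 , 13) ∷ (4 , 2 , 20) ∷ (0 , 7 , 10) ∷ (19 , 22 , 17) ∷ (30 , 5 , 8) ∷ (24 , 21 , 31) ∷ (18 , 26 , 29) ∷ (15 , 9 , 32) ∷ (27 , 25 , 16) ∷ (28 , 14 , 23) ∷ (12 , 3 , 11) ∷ [])
  ∷ ((7 , 2 , 14) ∷ (5 , 0 , 18) ∷ (1 , 8 , 11) ∷ (20 , 23 , 15) ∷ (31 , 3 , 6) ∷ (25 , 22 , 32) ∷ (19 , 24 , 27) ∷ (16 , 10 , 30) ∷ (28 , 26 , 17) ∷ (29 , 12 , 21) ∷ (13 , 4 , 9) ∷ [])
  ∷ ((8 , 0 , 12) ∷ (3 , 1 , 19) ∷ (2 , 6 , 9) ∷ (18 , 21 , 16) ∷ (32 , 4 , 7) ∷ (26 , 23 , 30) ∷ (20 , 25 , 28) ∷ (17 , 11 , 31) ∷ (29 , 24 , 15) ∷ (27 , 13 , 22) ∷ (14 , 5 , 10) ∷ [])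
  ∷ ((24 , 1 , 16) ∷ (13 , 2 , 8) ∷ (0 , 25 , 4) ∷ (7 , 19 , 29) ∷ (21 , 14 , 26) ∷ (30 , 18 , 22) ∷ (6 , 32 , 11) ∷ (27 , 3 , 23) ∷ (9 , 31 , 28) ∷ (10 , 17 , 20) ∷ (15 , 12 , 5) ∷ [])
  ∷ ((25 , 2 , 17) ∷ (14 , 0 , 6) ∷ (1 , 26 , 5) ∷ (8 , 20 , 27) ∷ (22 , 12 , 24) ∷ (31 , 19 , 23) ∷ (7 , 30 , 9) ∷ (28 , 4 , 21) ∷ (10 , 32 , 29) ∷ (11 , 15 , 18) ∷ (16 , 13 , 3) ∷ [])
  ∷ ((26 , 0 , 15) ∷ (12 , 1 , 7) ∷ (2 , 24 , 3) ∷ (6 , 18 , 28) ∷ (23 , 13 , 25) ∷ (32 , 20 , 21) ∷ (8 , 31 , 10) ∷ (29 , 5 , 22) ∷ (11 , 30 , 27) ∷ (9 , 16 , 19) ∷ (17 , 14 , 4) ∷ [])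
  ∷ ((30 , 1 , 28) ∷ (16 , 2 , 26) ∷ (0 , 31 , 13) ∷ (25 , 7 , 11) ∷ (18 , 17 , 32) ∷ (21 , 6 , 19) ∷ (24 , 23 , 5) ∷ (9 , 12 , 20) ∷ (3 , 22 , 10) ∷ (4 , 29 , 8) ∷ (27 , 15 , 14) ∷ [])
  ∷ ((31 , 2 , 29) ∷ (17 , 0 , 24) ∷ (1 , 32 , 14) ∷ (26 , 8 , 9) ∷ (19 , 15 , 30) ∷ (22 , 7 , 20) ∷ (25 , 21 , 3) ∷ (10 , 13 , 18) ∷ (4 , 23 , 11) ∷ (5 , 27 , 6) ∷ (28 , 16 , 12) ∷ [])
  ∷ ((32 , 0 , 27) ∷ (15 , 1 , 25) ∷ (2 , 30 , 12) ∷ (24 , 6 , 10) ∷ (20 , 16 , 31) ∷ (23 , 8 , 18) ∷ (26 , 22 , 4) ∷ (11 , 14 , 19) ∷ (5 , 21 , 9) ∷ (3 , 28 , 7) ∷ (29 , 17 , 13) ∷ [])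
  ∷ []

resolution39 : List (List Tripleℕ)
resolution39 =
    ((0 , 1 , 2) ∷ (3 , 4 , 5) ∷ (6 , 7 , 8) ∷ (9 , 10 , 11) ∷ (12 , 13 , 14) ∷ (15 , 16 , 17) ∷ (18 , 19 , 20) ∷ (21 , 22 , 23) ∷ (24 , 25 , 26) ∷ (27 , 28 , 29) ∷ (30 , 31 , 32) ∷ (33 , 34 , 35) ∷ (36 , 37 , 38) ∷ [])
  ∷ ((0 , 30 , 28) ∷ (36 , 1 , 7) ∷ (4 , 19 , 2) ∷ (3 , 17 , 23) ∷ (10 , 25 , 29) ∷ (6 , 9 , 31) ∷ (12 , 27 , 38) ∷ (16 , 34 , 26) ∷ (18 , 5 , 11) ∷ (21 , 32 , 35) ∷ (22 , 14 , 20) ∷ (15 , 24 , 8) ∷ (33 , 13 , 37) ∷ [])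
  ∷ ((1 , 31 , 29) ∷ (37 , 2 , 8) ∷ (5 , 20 , 0) ∷ (4 , 15 , 21) ∷ (11 , 26 , 27) ∷ (7 , 10 , 32) ∷ (13 , 28 , 36) ∷ (17 , 35 , 24) ∷ (19 , 3 , 9) ∷ (22 , 30 , 33) ∷ (23 , 12 , 18) ∷ (16 , 25 , 6) ∷ (34 , 14 , 38) ∷ [])
  ∷ ((2 , 32 , 27) ∷ (38 , 0 , 6) ∷ (3 , 18 , 1) ∷ (5 , 16 , 22) ∷ (9 , 24 , 28) ∷ (8 , 11 , 30) ∷ (14 , 29 , 37) ∷ (15 , 33 , 25) ∷ (20 , 4 , 10) ∷ (23 , 31 , 34) ∷ (21 , 13 , 19) ∷ (17 , 26 , 7) ∷ (35 , 12 , 36) ∷ [])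
  ∷ ((0 , 12 , 4) ∷ (30 , 1 , 19) ∷ (10 , 16 , 2) ∷ (9 , 8 , 26) ∷ (28 , 34 , 5) ∷ (18 , 27 , 13) ∷ (36 , 3 , 32) ∷ (7 , 22 , 35) ∷ (15 , 11 , 29) ∷ (24 , 14 , 23) ∷ (25 , 38 , 17) ∷ (6 , 33 , 20) ∷ (21 , 37 , 31) ∷ [])
  ∷ ((1 , 13 , 5) ∷ (31 , 2 , 20) ∷ (11 , 17 , 0) ∷ (10 , 6 , 24) ∷ (29 , 35 , 3) ∷ (19 , 28 , 14) ∷ (37 , 4 , 30) ∷ (8 , 23 , 33) ∷ (16 , 9 , 27) ∷ (25 , 12 , 21) ∷ (26 , 36 , 15) ∷ (7 , 34 , 18) ∷ (22 , 38 , 32) ∷ [])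
  ∷ ((2 , 14 , 3) ∷ (32 , 0 , 18) ∷ (9 , 15 , 1) ∷ (11 , 7 , 25) ∷ (27 , 33 , 4) ∷ (20 , 29 , 12) ∷ (38 , 5 , 31) ∷ (6 , 21 , 34) ∷ (17 , 10 , 28) ∷ (26 , 13 , 22) ∷ (24 , 37 , 16) ∷ (8 , 35 , 19) ∷ (23 , 36 , 30) ∷ [])
  ∷ ((0 , 36 , 10) ∷ (12 , 1 , 16) ∷ (28 , 7 , 2) ∷ (27 , 20 , 35) ∷ (4 , 22 , 11) ∷ (15 , 3 , 37) ∷ (30 , 9 , 14) ∷ (19 , 25 , 23) ∷ (6 , 29 , 5) ∷ (33 , 38 , 26) ∷ (34 , 32 , 8) ∷ (18 , 21 , 17) ∷ (24 , 31 , 13) ∷ [])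
  ∷ ((1 , 37 , 11) ∷ (13 , 2 , 17) ∷ (29 , 8 , 0) ∷ (28 , 18 , 33) ∷ (5 , 23 , 9) ∷ (16 , 4 , 38) ∷ (31 , 10 , 12) ∷ (20 , 26 , 21) ∷ (7 , 27 , 3) ∷ (34 , 36 , 24) ∷ (35 , 30 , 6) ∷ (19 , 22 , 15) ∷ (25 , 32 , 14) ∷ [])
  ∷ ((2 , 38 , 9) ∷ (14 , 0 , 15) ∷ (27 , 6 , 1) ∷ (29 , 19 , 34) ∷ (3 , 21 , 10) ∷ (17 , 5 , 36) ∷ (32 , 11 , 13) ∷ (18 , 24 , 22) ∷ (8 , 28 , 4) ∷ (35 , 37 , 25) ∷ (33 , 31 , 7) ∷ (20 , 23 , 16) ∷ (26 , 30 , 12) ∷ [])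
  ∷ ((0 , 22 , 31) ∷ (18 , 2 , 35) ∷ (21 , 1 , 28) ∷ (6 , 11 , 23) ∷ (24 , 33 , 29) ∷ (3 , 30 , 25) ∷ (15 , 10 , 34) ∷ (37 , 26 , 32) ∷ (9 , 4 , 13) ∷ (27 , 14 , 17) ∷ (7 , 20 , 38) ∷ (36 , 16 , 19) ∷ (12 , 5 , 8) ∷ [])
  ∷ ((1 , 23 , 32) ∷ (19 , 0 , 33) ∷ (22 , 2 , 29) ∷ (7 , 9 , 21) ∷ (25 , 34 , 27) ∷ (4 , 31 , 26) ∷ (16 , 11 , 35) ∷ (38 , 24 , 30) ∷ (10 , 5 , 14) ∷ (28 , 12 , 15) ∷ (8 , 18 , 36) ∷ (37 , 17 , 20) ∷ (13 , 3 , 6) ∷ [])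
  ∷ ((2 , 21 , 30) ∷ (20 , 1 , 34) ∷ (23 , 0 , 27) ∷ (8 , 10 , 22) ∷ (26 , 35 , 28) ∷ (5 , 32 , 24) ∷ (17 , 9 , 33) ∷ (36 , 25 , 31) ∷ (11 , 3 , 12) ∷ (29 , 13 , 16) ∷ (6 , 19 , 37) ∷ (38 , 15 , 18) ∷ (14 , 4 , 7) ∷ [])
  ∷ ((0 , 25 , 13) ∷ (15 , 2 , 23) ∷ (24 , 1 , 4) ∷ (18 , 29 , 26) ∷ (33 , 21 , 5) ∷ (9 , 12 , 34) ∷ (6 , 28 , 22) ∷ (31 , 35 , 14) ∷ (27 , 10 , 37) ∷ (3 , 38 , 8) ∷ (19 , 17 , 32) ∷ (30 , 7 , 16) ∷ (36 , 11 , 20) ∷ [])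
  ∷ ((1 , 26 , 14) ∷ (16 , 0 , 21) ∷ (25 , 2 , 5) ∷ (19 , 27 , 24) ∷ (34 , 22 , 3) ∷ (10 , 13 , 35) ∷ (7 , 29 , 23) ∷ (32 , 33 , 12) ∷ (28 , 11 , 38) ∷ (4 , 36 , 6) ∷ (20 , 15 , 30) ∷ (31 , 8 , 17) ∷ (37 , 9 , 18) ∷ [])
  ∷ ((2 , 24 , 12) ∷ (17 , 1 , 22) ∷ (26 , 0 , 3) ∷ (20 , 28 , 25) ∷ (35 , 23 , 4) ∷ (11 , 14 , 33) ∷ (8 , 27 , 21) ∷ (30 , 34 , 13) ∷ (29 , 9 , 36) ∷ (5 , 37 , 7) ∷ (18 , 16 , 31) ∷ (32 , 6 , 15) ∷ (38 , 10 , 19) ∷ [])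
  ∷ ((0 , 34 , 37) ∷ (6 , 2 , 26) ∷ (33 , 1 , 10) ∷ (15 , 5 , 35) ∷ (21 , 24 , 11) ∷ (27 , 36 , 22) ∷ (18 , 4 , 25) ∷ (13 , 23 , 38) ∷ (3 , 28 , 31) ∷ (9 , 32 , 20) ∷ (16 , 8 , 14) ∷ (12 , 19 , 7) ∷ (30 , 29 , 17) ∷ [])
  ∷ ((1 , 35 , 38) ∷ (7 , 0 , 24) ∷ (34 , 2 , 11) ∷ (16 , 3 , 33) ∷ (22 , 25 , 9) ∷ (28 , 37 , 23) ∷ (19 , 5 , 26) ∷ (14 , 21 , 36) ∷ (4 , 29 , 32) ∷ (10 , 30 , 18) ∷ (17 , 6 , 12) ∷ (13 , 20 , 8) ∷ (31 , 27 , 15) ∷ [])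
  ∷ ((2 , 33 , 36) ∷ (8 , 1 , 25) ∷ (35 , 0 , 9) ∷ (17 , 4 , 34) ∷ (23 , 26 , 10) ∷ (29 , 38 , 21) ∷ (20 , 3 , 24) ∷ (12 , 22 , 37) ∷ (5 , 27 , 30) ∷ (11 , 31 , 19) ∷ (15 , 7 , 13) ∷ (14 , 18 , 6) ∷ (32 , 28 , 16) ∷ [])
  ∷ []

resolution57 : List (List Tripleℕ)
resolution57 =
    ((0 , 1 , 2) ∷ (3 , 4 , 5) ∷ (6 , 7 , 8) ∷ (9 , 10 , 11) ∷ (12 , 13 , 14) ∷ (15 , 16 , 17) ∷ (18 , 19 , 20) ∷ (21 , 22 , 23) ∷ (24 , 25 , 26) ∷ (27 , 28 , 29) ∷ (30 , 31 , 32) ∷ (33 , 34 , 35) ∷ (36 , 37 , 38) ∷ (39 , 40 , 41) ∷ (42 , 43 , 44) ∷ (45 , 46 , 47) ∷ (48 , 49 , 50) ∷ (51 , 52 , 53) ∷ (54 , 55 , 56) ∷ [])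
  ∷ ((33 , 1 , 22) ∷ (0 , 30 , 47) ∷ (18 , 45 , 2) ∷ (6 , 39 , 34) ∷ (36 , 32 , 41) ∷ (42 , 13 , 37) ∷ (52 , 55 , 11) ∷ (54 , 4 , 40) ∷ (24 , 8 , 56) ∷ (7 , 25 , 5) ∷ (51 , 23 , 44) ∷ (46 , 17 , 35) ∷ (16 , 29 , 38) ∷ (19 , 26 , 53) ∷ (9 , 14 , 50) ∷ (15 , 48 , 20) ∷ (3 , 27 , 10) ∷ (12 , 28 , 31) ∷ (21 , 43 , 49) ∷ [])
  ∷ ((34 , 2 , 23) ∷ (1 , 31 , 45) ∷ (19 , 46 , 0) ∷ (7 , 40 , 35) ∷ (37 , 30 , 39) ∷ (43 , 14 , 38) ∷ (53 , 56 , 9) ∷ (55 , 5 , 41) ∷ (25 , 6 , 54) ∷ (8 , 26 , 3) ∷ (52 , 21 , 42) ∷ (47 , 15 , 33) ∷ (17 , 27 , 36) ∷ (20 , 24 , 51) ∷ (10 , 12 , 48) ∷ (16 , 49 , 18) ∷ (4 , 28 , 11) ∷ (13 , 29 , 32) ∷ (22 , 44 , 50) ∷ [])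
  ∷ ((35 , 0 , 21) ∷ (2 , 32 , 46) ∷ (20 , 47 , 1) ∷ (8 , 41 , 33) ∷ (38 , 31 , 40) ∷ (44 , 12 , 36) ∷ (51 , 54 , 10) ∷ (56 , 3 , 39) ∷ (26 , 7 , 55) ∷ (6 , 24 , 4) ∷ (53 , 22 , 43) ∷ (45 , 16 , 34) ∷ (15 , 28 , 37) ∷ (18 , 25 , 52) ∷ (11 , 13 , 49) ∷ (17 , 50 , 19) ∷ (5 , 29 , 9) ∷ (14 , 27 , 30) ∷ (23 , 42 , 48) ∷ [])
  ∷ ((18 , 1 , 28) ∷ (0 , 6 , 11) ∷ (15 , 9 , 2) ∷ (24 , 42 , 19) ∷ (30 , 8 , 44) ∷ (54 , 49 , 31) ∷ (34 , 46 , 38) ∷ (45 , 13 , 43) ∷ (39 , 26 , 47) ∷ (25 , 40 , 14) ∷ (33 , 29 , 56) ∷ (10 , 5 , 20) ∷ (4 , 53 , 32) ∷ (16 , 41 , 35) ∷ (36 , 50 , 23) ∷ (3 , 21 , 17) ∷ (12 , 51 , 37) ∷ (48 , 52 , 7) ∷ (27 , 55 , 22) ∷ [])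
  ∷ ((19 , 2 , 29) ∷ (1 , 7 , 9) ∷ (16 , 10 , 0) ∷ (25 , 43 , 20) ∷ (31 , 6 , 42) ∷ (55 , 50 , 32) ∷ (35 , 47 , 36) ∷ (46 , 14 , 44) ∷ (40 , 24 , 45) ∷ (26 , 41 , 12) ∷ (34 , 27 , 54) ∷ (11 , 3 , 18) ∷ (5 , 51 , 30) ∷ (17 , 39 , 33) ∷ (37 , 48 , 21) ∷ (4 , 22 , 15) ∷ (13 , 52 , 38) ∷ (49 , 53 , 8) ∷ (28 , 56 , 23) ∷ [])
  ∷ ((20 , 0 , 27) ∷ (2 , 8 , 10) ∷ (17 , 11 , 1) ∷ (26 , 44 , 18) ∷ (32 , 7 , 43) ∷ (56 , 48 , 30) ∷ (33 , 45 , 37) ∷ (47 , 12 , 42) ∷ (41 , 25 , 46) ∷ (24 , 39 , 13) ∷ (35 , 28 , 55) ∷ (9 , 4 , 19) ∷ (3 , 52 , 31) ∷ (15 , 40 , 34) ∷ (38 , 49 , 22) ∷ (5 , 23 , 16) ∷ (14 , 53 , 36) ∷ (50 , 51 , 6) ∷ (29 , 54 , 21) ∷ [])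
  ∷ ((51 , 1 , 49) ∷ (0 , 36 , 56) ∷ (33 , 54 , 2) ∷ (30 , 24 , 52) ∷ (9 , 38 , 26) ∷ (39 , 4 , 10) ∷ (28 , 43 , 47) ∷ (42 , 16 , 25) ∷ (6 , 32 , 44) ∷ (31 , 7 , 17) ∷ (27 , 50 , 41) ∷ (55 , 20 , 53) ∷ (19 , 23 , 11) ∷ (34 , 8 , 29) ∷ (45 , 5 , 14) ∷ (18 , 12 , 35) ∷ (15 , 21 , 46) ∷ (3 , 22 , 37) ∷ (48 , 40 , 13) ∷ [])
  ∷ ((52 , 2 , 50) ∷ (1 , 37 , 54) ∷ (34 , 55 , 0) ∷ (31 , 25 , 53) ∷ (10 , 36 , 24) ∷ (40 , 5 , 11) ∷ (29 , 44 , 45) ∷ (43 , 17 , 26) ∷ (7 , 30 , 42) ∷ (32 , 8 , 15) ∷ (28 , 48 , 39) ∷ (56 , 18 , 51) ∷ (20 , 21 , 9) ∷ (35 , 6 , 27) ∷ (46 , 3 , 12) ∷ (19 , 13 , 33) ∷ (16 , 22 , 47) ∷ (4 , 23 , 38) ∷ (49 , 41 , 14) ∷ [])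
  ∷ ((53 , 0 , 48) ∷ (2 , 38 , 55) ∷ (35 , 56 , 1) ∷ (32 , 26 , 51) ∷ (11 , 37 , 25) ∷ (41 , 3 , 9) ∷ (27 , 42 , 46) ∷ (44 , 15 , 24) ∷ (8 , 31 , 43) ∷ (30 , 6 , 16) ∷ (29 , 49 , 40) ∷ (54 , 19 , 52) ∷ (18 , 22 , 10) ∷ (33 , 7 , 28) ∷ (47 , 4 , 13) ∷ (20 , 14 , 34) ∷ (17 , 23 , 45) ∷ (5 , 21 , 36) ∷ (50 , 39 , 12) ∷ [])
  ∷ ((27 , 1 , 13) ∷ (0 , 9 , 44) ∷ (51 , 42 , 2) ∷ (36 , 6 , 28) ∷ (45 , 11 , 8) ∷ (24 , 16 , 46) ∷ (22 , 40 , 56) ∷ (39 , 19 , 7) ∷ (30 , 38 , 41) ∷ (37 , 31 , 20) ∷ (21 , 14 , 26) ∷ (43 , 35 , 29) ∷ (34 , 50 , 47) ∷ (52 , 32 , 23) ∷ (54 , 17 , 5) ∷ (33 , 3 , 53) ∷ (18 , 48 , 55) ∷ (15 , 49 , 10) ∷ (12 , 25 , 4) ∷ [])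
  ∷ ((28 , 2 , 14) ∷ (1 , 10 , 42) ∷ (52 , 43 , 0) ∷ (37 , 7 , 29) ∷ (46 , 9 , 6) ∷ (25 , 17 , 47) ∷ (23 , 41 , 54) ∷ (40 , 20 , 8) ∷ (31 , 36 , 39) ∷ (38 , 32 , 18) ∷ (22 , 12 , 24) ∷ (44 , 33 , 27) ∷ (35 , 48 , 45) ∷ (53 , 30 , 21) ∷ (55 , 15 , 3) ∷ (34 , 4 , 51) ∷ (19 , 49 , 56) ∷ (16 , 50 , 11) ∷ (13 , 26 , 5) ∷ [])
  ∷ ((29 , 0 , 12) ∷ (2 , 11 , 43) ∷ (53 , 44 , 1) ∷ (38 , 8 , 27) ∷ (47 , 10 , 7) ∷ (26 , 15 , 45) ∷ (21 , 39 , 55) ∷ (41 , 18 , 6) ∷ (32 , 37 , 40) ∷ (36 , 30 , 19) ∷ (23 , 13 , 25) ∷ (42 , 34 , 28) ∷ (33 , 49 , 46) ∷ (51 , 31 , 22) ∷ (56 , 16 , 4) ∷ (35 , 5 , 52) ∷ (20 , 50 , 54) ∷ (17 , 48 , 9) ∷ (14 , 24 , 3) ∷ [])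
  ∷ ((3 , 1 , 34) ∷ (0 , 39 , 32) ∷ (12 , 30 , 2) ∷ (42 , 45 , 4) ∷ (24 , 41 , 47) ∷ (9 , 28 , 25) ∷ (16 , 37 , 8) ∷ (36 , 22 , 46) ∷ (54 , 44 , 38) ∷ (43 , 55 , 23) ∷ (15 , 35 , 11) ∷ (31 , 50 , 5) ∷ (49 , 20 , 26) ∷ (13 , 56 , 17) ∷ (6 , 29 , 53) ∷ (48 , 51 , 14) ∷ (21 , 18 , 7) ∷ (27 , 19 , 40) ∷ (33 , 10 , 52) ∷ [])
  ∷ ((4 , 2 , 35) ∷ (1 , 40 , 30) ∷ (13 , 31 , 0) ∷ (43 , 46 , 5) ∷ (25 , 39 , 45) ∷ (10 , 29 , 26) ∷ (17 , 38 , 6) ∷ (37 , 23 , 47) ∷ (55 , 42 , 36) ∷ (44 , 56 , 21) ∷ (16 , 33 , 9) ∷ (32 , 48 , 3) ∷ (50 , 18 , 24) ∷ (14 , 54 , 15) ∷ (7 , 27 , 51) ∷ (49 , 52 , 12) ∷ (22 , 19 , 8) ∷ (28 , 20 , 41) ∷ (34 , 11 , 53) ∷ [])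
  ∷ ((5 , 0 , 33) ∷ (2 , 41 , 31) ∷ (14 , 32 , 1) ∷ (44 , 47 , 3) ∷ (26 , 40 , 46) ∷ (11 , 27 , 24) ∷ (15 , 36 , 7) ∷ (38 , 21 , 45) ∷ (56 , 43 , 37) ∷ (42 , 54 , 22) ∷ (17 , 34 , 10) ∷ (30 , 49 , 4) ∷ (48 , 19 , 25) ∷ (12 , 55 , 16) ∷ (8 , 28 , 52) ∷ (50 , 53 , 13) ∷ (23 , 20 , 6) ∷ (29 , 18 , 39) ∷ (35 , 9 , 51) ∷ [])
  ∷ ((12 , 1 , 19) ∷ (0 , 42 , 8) ∷ (48 , 6 , 2) ∷ (54 , 9 , 13) ∷ (39 , 44 , 11) ∷ (36 , 52 , 40) ∷ (4 , 31 , 26) ∷ (30 , 28 , 10) ∷ (45 , 56 , 32) ∷ (55 , 46 , 29) ∷ (3 , 20 , 38) ∷ (7 , 23 , 14) ∷ (22 , 17 , 41) ∷ (49 , 47 , 5) ∷ (24 , 53 , 35) ∷ (21 , 33 , 50) ∷ (27 , 15 , 25) ∷ (51 , 16 , 43) ∷ (18 , 37 , 34) ∷ [])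
  ∷ ((13 , 2 , 20) ∷ (1 , 43 , 6) ∷ (49 , 7 , 0) ∷ (55 , 10 , 14) ∷ (40 , 42 , 9) ∷ (37 , 53 , 41) ∷ (5 , 32 , 24) ∷ (31 , 29 , 11) ∷ (46 , 54 , 30) ∷ (56 , 47 , 27) ∷ (4 , 18 , 36) ∷ (8 , 21 , 12) ∷ (23 , 15 , 39) ∷ (50 , 45 , 3) ∷ (25 , 51 , 33) ∷ (22 , 34 , 48) ∷ (28 , 16 , 26) ∷ (52 , 17 , 44) ∷ (19 , 38 , 35) ∷ [])
  ∷ ((14 , 0 , 18) ∷ (2 , 44 , 7) ∷ (50 , 8 , 1) ∷ (56 , 11 , 12) ∷ (41 , 43 , 10) ∷ (38 , 51 , 39) ∷ (3 , 30 , 25) ∷ (32 , 27 , 9) ∷ (47 , 55 , 31) ∷ (54 , 45 , 28) ∷ (5 , 19 , 37) ∷ (6 , 22 , 13) ∷ (21 , 16 , 40) ∷ (48 , 46 , 4) ∷ (26 , 52 , 34) ∷ (23 , 35 , 49) ∷ (29 , 17 , 24) ∷ (53 , 15 , 42) ∷ (20 , 36 , 33) ∷ [])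
  ∷ ((21 , 1 , 4) ∷ (0 , 45 , 41) ∷ (27 , 39 , 2) ∷ (9 , 30 , 22) ∷ (54 , 47 , 32) ∷ (6 , 19 , 55) ∷ (49 , 25 , 44) ∷ (24 , 34 , 31) ∷ (36 , 11 , 26) ∷ (10 , 37 , 35) ∷ (48 , 5 , 8) ∷ (40 , 53 , 23) ∷ (52 , 14 , 56) ∷ (28 , 38 , 50) ∷ (42 , 20 , 17) ∷ (51 , 15 , 29) ∷ (33 , 12 , 43) ∷ (18 , 13 , 46) ∷ (3 , 7 , 16) ∷ [])
  ∷ ((22 , 2 , 5) ∷ (1 , 46 , 39) ∷ (28 , 40 , 0) ∷ (10 , 31 , 23) ∷ (55 , 45 , 30) ∷ (7 , 20 , 56) ∷ (50 , 26 , 42) ∷ (25 , 35 , 32) ∷ (37 , 9 , 24) ∷ (11 , 38 , 33) ∷ (49 , 3 , 6) ∷ (41 , 51 , 21) ∷ (53 , 12 , 54) ∷ (29 , 36 , 48) ∷ (43 , 18 , 15) ∷ (52 , 16 , 27) ∷ (34 , 13 , 44) ∷ (19 , 14 , 47) ∷ (4 , 8 , 17) ∷ [])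
  ∷ ((23 , 0 , 3) ∷ (2 , 47 , 40) ∷ (29 , 41 , 1) ∷ (11 , 32 , 21) ∷ (56 , 46 , 31) ∷ (8 , 18 , 54) ∷ (48 , 24 , 43) ∷ (26 , 33 , 30) ∷ (38 , 10 , 25) ∷ (9 , 36 , 34) ∷ (50 , 4 , 7) ∷ (39 , 52 , 22) ∷ (51 , 13 , 55) ∷ (27 , 37 , 49) ∷ (44 , 19 , 16) ∷ (53 , 17 , 28) ∷ (35 , 14 , 42) ∷ (20 , 12 , 45) ∷ (5 , 6 , 15) ∷ [])
  ∷ ((15 , 1 , 52) ∷ (0 , 24 , 38) ∷ (3 , 36 , 2) ∷ (39 , 54 , 16) ∷ (6 , 26 , 56) ∷ (45 , 22 , 7) ∷ (19 , 10 , 32) ∷ (9 , 49 , 55) ∷ (42 , 41 , 11) ∷ (40 , 43 , 50) ∷ (18 , 53 , 47) ∷ (37 , 14 , 17) ∷ (13 , 35 , 8) ∷ (4 , 44 , 20) ∷ (30 , 23 , 29) ∷ (12 , 27 , 5) ∷ (48 , 33 , 31) ∷ (21 , 34 , 25) ∷ (51 , 46 , 28) ∷ [])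
  ∷ ((16 , 2 , 53) ∷ (1 , 25 , 36) ∷ (4 , 37 , 0) ∷ (40 , 55 , 17) ∷ (7 , 24 , 54) ∷ (46 , 23 , 8) ∷ (20 , 11 , 30) ∷ (10 , 50 , 56) ∷ (43 , 39 , 9) ∷ (41 , 44 , 48) ∷ (19 , 51 , 45) ∷ (38 , 12 , 15) ∷ (14 , 33 , 6) ∷ (5 , 42 , 18) ∷ (31 , 21 , 27) ∷ (13 , 28 , 3) ∷ (49 , 34 , 32) ∷ (22 , 35 , 26) ∷ (52 , 47 , 29) ∷ [])
  ∷ ((17 , 0 , 51) ∷ (2 , 26 , 37) ∷ (5 , 38 , 1) ∷ (41 , 56 , 15) ∷ (8 , 25 , 55) ∷ (47 , 21 , 6) ∷ (18 , 9 , 31) ∷ (11 , 48 , 54) ∷ (44 , 40 , 10) ∷ (39 , 42 , 49) ∷ (20 , 52 , 46) ∷ (36 , 13 , 16) ∷ (12 , 34 , 7) ∷ (3 , 43 , 19) ∷ (32 , 22 , 28) ∷ (14 , 29 , 4) ∷ (50 , 35 , 30) ∷ (23 , 33 , 24) ∷ (53 , 45 , 27) ∷ [])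
  ∷ ((48 , 1 , 16) ∷ (0 , 54 , 26) ∷ (21 , 24 , 2) ∷ (45 , 36 , 49) ∷ (42 , 56 , 38) ∷ (30 , 34 , 43) ∷ (13 , 7 , 41) ∷ (6 , 52 , 37) ∷ (9 , 47 , 8) ∷ (46 , 10 , 53) ∷ (12 , 17 , 32) ∷ (25 , 29 , 50) ∷ (28 , 5 , 44) ∷ (22 , 11 , 14) ∷ (39 , 35 , 20) ∷ (27 , 18 , 23) ∷ (51 , 3 , 40) ∷ (33 , 4 , 55) ∷ (15 , 31 , 19) ∷ [])
  ∷ ((49 , 2 , 17) ∷ (1 , 55 , 24) ∷ (22 , 25 , 0) ∷ (46 , 37 , 50) ∷ (43 , 54 , 36) ∷ (31 , 35 , 44) ∷ (14 , 8 , 39) ∷ (7 , 53 , 38) ∷ (10 , 45 , 6) ∷ (47 , 11 , 51) ∷ (13 , 15 , 30) ∷ (26 , 27 , 48) ∷ (29 , 3 , 42) ∷ (23 , 9 , 12) ∷ (40 , 33 , 18) ∷ (28 , 19 , 21) ∷ (52 , 4 , 41) ∷ (34 , 5 , 56) ∷ (16 , 32 , 20) ∷ [])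
  ∷ ((50 , 0 , 15) ∷ (2 , 56 , 25) ∷ (23 , 26 , 1) ∷ (47 , 38 , 48) ∷ (44 , 55 , 37) ∷ (32 , 33 , 42) ∷ (12 , 6 , 40) ∷ (8 , 51 , 36) ∷ (11 , 46 , 7) ∷ (45 , 9 , 52) ∷ (14 , 16 , 31) ∷ (24 , 28 , 49) ∷ (27 , 4 , 43) ∷ (21 , 10 , 13) ∷ (41 , 34 , 19) ∷ (29 , 20 , 22) ∷ (53 , 5 , 39) ∷ (35 , 3 , 54) ∷ (17 , 30 , 18) ∷ [])
  ∷ []

resolution69 : List (List Tripleℕ)
resolution69 =
    ((0 , 1 , 2) ∷ (3 , 4 , 5) ∷ (6 , 7 , 8) ∷ (9 , 10 , 11) ∷ (12 , 13 , 14) ∷ (15 , 16 , 17) ∷ (18 , 19 , 20) ∷ (21 , 22 , 23) ∷ (24 , 25 , 26) ∷ (27 , 28 , 29) ∷ (30 , 31 , 32) ∷ (33 , 34 , 35) ∷ (36 , 37 , 38) ∷ (39 , 40 , 41) ∷ (42 , 43 , 44) ∷ (45 , 46 , 47) ∷ (48 , 49 , 50) ∷ (51 , 52 , 53) ∷ (54 , 55 , 56) ∷ (57 , 58 , 59) ∷ (60 , 61 , 62) ∷ (63 , 64 , 65) ∷ (66 , 67 , 68) ∷ [])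
  ∷ ((18 , 60 , 1) ∷ (21 , 2 , 14) ∷ (0 , 66 , 13) ∷ (63 , 31 , 43) ∷ (39 , 32 , 62) ∷ (67 , 47 , 53) ∷ (30 , 38 , 44) ∷ (22 , 64 , 68) ∷ (45 , 4 , 61) ∷ (28 , 52 , 35) ∷ (48 , 34 , 46) ∷ (51 , 29 , 65) ∷ (6 , 15 , 56) ∷ (7 , 58 , 26) ∷ (25 , 11 , 17) ∷ (27 , 54 , 59) ∷ (16 , 8 , 50) ∷ (10 , 55 , 23) ∷ (12 , 42 , 37) ∷ (9 , 24 , 40) ∷ (49 , 5 , 41) ∷ (33 , 36 , 20) ∷ (3 , 57 , 19) ∷ [])
  ∷ ((19 , 61 , 2) ∷ (22 , 0 , 12) ∷ (1 , 67 , 14) ∷ (64 , 32 , 44) ∷ (40 , 30 , 60) ∷ (68 , 45 , 51) ∷ (31 , 36 , 42) ∷ (23 , 65 , 66) ∷ (46 , 5 , 62) ∷ (29 , 53 , 33) ∷ (49 , 35 , 47) ∷ (52 , 27 , 63) ∷ (7 , 16 , 54) ∷ (8 , 59 , 24) ∷ (26 , 9 , 15) ∷ (28 , 55 , 57) ∷ (17 , 6 , 48) ∷ (11 , 56 , 21) ∷ (13 , 43 , 38) ∷ (10 , 25 , 41) ∷ (50 , 3 , 39) ∷ (34 , 37 , 18) ∷ (4 , 58 , 20) ∷ [])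
  ∷ ((20 , 62 , 0) ∷ (23 , 1 , 13) ∷ (2 , 68 , 12) ∷ (65 , 30 , 42) ∷ (41 , 31 , 61) ∷ (66 , 46 , 52) ∷ (32 , 37 , 43) ∷ (21 , 63 , 67) ∷ (47 , 3 , 60) ∷ (27 , 51 , 34) ∷ (50 , 33 , 45) ∷ (53 , 28 , 64) ∷ (8 , 17 , 55) ∷ (6 , 57 , 25) ∷ (24 , 10 , 16) ∷ (29 , 56 , 58) ∷ (15 , 7 , 49) ∷ (9 , 54 , 22) ∷ (14 , 44 , 36) ∷ (11 , 26 , 39) ∷ (48 , 4 , 40) ∷ (35 , 38 , 19) ∷ (5 , 59 , 18) ∷ [])
  ∷ ((36 , 51 , 1) ∷ (42 , 2 , 26) ∷ (0 , 63 , 25) ∷ (57 , 61 , 16) ∷ (9 , 62 , 53) ∷ (64 , 23 , 35) ∷ (60 , 5 , 17) ∷ (43 , 58 , 65) ∷ (21 , 7 , 52) ∷ (55 , 34 , 68) ∷ (27 , 67 , 22) ∷ (33 , 56 , 59) ∷ (12 , 30 , 41) ∷ (13 , 46 , 50) ∷ (49 , 20 , 32) ∷ (54 , 39 , 47) ∷ (31 , 14 , 29) ∷ (19 , 40 , 44) ∷ (24 , 15 , 4) ∷ (18 , 48 , 10) ∷ (28 , 8 , 11) ∷ (66 , 3 , 38) ∷ (6 , 45 , 37) ∷ [])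
  ∷ ((37 , 52 , 2) ∷ (43 , 0 , 24) ∷ (1 , 64 , 26) ∷ (58 , 62 , 17) ∷ (10 , 60 , 51) ∷ (65 , 21 , 33) ∷ (61 , 3 , 15) ∷ (44 , 59 , 63) ∷ (22 , 8 , 53) ∷ (56 , 35 , 66) ∷ (28 , 68 , 23) ∷ (34 , 54 , 57) ∷ (13 , 31 , 39) ∷ (14 , 47 , 48) ∷ (50 , 18 , 30) ∷ (55 , 40 , 45) ∷ (32 , 12 , 27) ∷ (20 , 41 , 42) ∷ (25 , 16 , 5) ∷ (19 , 49 , 11) ∷ (29 , 6 , 9) ∷ (67 , 4 , 36) ∷ (7 , 46 , 38) ∷ [])
  ∷ ((38 , 53 , 0) ∷ (44 , 1 , 25) ∷ (2 , 65 , 24) ∷ (59 , 60 , 15) ∷ (11 , 61 , 52) ∷ (63 , 22 , 34) ∷ (62 , 4 , 16) ∷ (42 , 57 , 64) ∷ (23 , 6 , 51) ∷ (54 , 33 , 67) ∷ (29 , 66 , 21) ∷ (35 , 55 , 58) ∷ (14 , 32 , 40) ∷ (12 , 45 , 49) ∷ (48 , 19 , 31) ∷ (56 , 41 , 46) ∷ (30 , 13 , 28) ∷ (18 , 39 , 43) ∷ (26 , 17 , 3) ∷ (20 , 50 , 9) ∷ (27 , 7 , 10) ∷ (68 , 5 , 37) ∷ (8 , 47 , 36) ∷ [])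
  ∷ ((54 , 42 , 1) ∷ (63 , 2 , 38) ∷ (0 , 60 , 37) ∷ (51 , 22 , 58) ∷ (48 , 23 , 44) ∷ (61 , 68 , 17) ∷ (21 , 41 , 59) ∷ (64 , 52 , 62) ∷ (66 , 10 , 43) ∷ (13 , 16 , 32) ∷ (6 , 31 , 67) ∷ (15 , 14 , 53) ∷ (18 , 45 , 26) ∷ (19 , 34 , 5) ∷ (4 , 29 , 47) ∷ (12 , 24 , 35) ∷ (46 , 20 , 8) ∷ (28 , 25 , 65) ∷ (36 , 57 , 40) ∷ (27 , 3 , 49) ∷ (7 , 11 , 50) ∷ (30 , 39 , 56) ∷ (9 , 33 , 55) ∷ [])
  ∷ ((55 , 43 , 2) ∷ (64 , 0 , 36) ∷ (1 , 61 , 38) ∷ (52 , 23 , 59) ∷ (49 , 21 , 42) ∷ (62 , 66 , 15) ∷ (22 , 39 , 57) ∷ (65 , 53 , 60) ∷ (67 , 11 , 44) ∷ (14 , 17 , 30) ∷ (7 , 32 , 68) ∷ (16 , 12 , 51) ∷ (19 , 46 , 24) ∷ (20 , 35 , 3) ∷ (5 , 27 , 45) ∷ (13 , 25 , 33) ∷ (47 , 18 , 6) ∷ (29 , 26 , 63) ∷ (37 , 58 , 41) ∷ (28 , 4 , 50) ∷ (8 , 9 , 48) ∷ (31 , 40 , 54) ∷ (10 , 34 , 56) ∷ [])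
  ∷ ((56 , 44 , 0) ∷ (65 , 1 , 37) ∷ (2 , 62 , 36) ∷ (53 , 21 , 57) ∷ (50 , 22 , 43) ∷ (60 , 67 , 16) ∷ (23 , 40 , 58) ∷ (63 , 51 , 61) ∷ (68 , 9 , 42) ∷ (12 , 15 , 31) ∷ (8 , 30 , 66) ∷ (17 , 13 , 52) ∷ (20 , 47 , 25) ∷ (18 , 33 , 4) ∷ (3 , 28 , 46) ∷ (14 , 26 , 34) ∷ (45 , 19 , 7) ∷ (27 , 24 , 64) ∷ (38 , 59 , 39) ∷ (29 , 5 , 48) ∷ (6 , 10 , 49) ∷ (32 , 41 , 55) ∷ (11 , 35 , 54) ∷ [])
  ∷ ((3 , 33 , 1) ∷ (15 , 2 , 50) ∷ (0 , 57 , 49) ∷ (45 , 52 , 31) ∷ (18 , 53 , 35) ∷ (58 , 44 , 68) ∷ (51 , 8 , 32) ∷ (16 , 46 , 59) ∷ (42 , 13 , 34) ∷ (40 , 67 , 65) ∷ (54 , 64 , 43) ∷ (66 , 41 , 47) ∷ (24 , 60 , 11) ∷ (25 , 22 , 29) ∷ (28 , 38 , 62) ∷ (39 , 9 , 23) ∷ (61 , 26 , 56) ∷ (37 , 10 , 17) ∷ (48 , 30 , 7) ∷ (36 , 27 , 19) ∷ (55 , 14 , 20) ∷ (63 , 6 , 5) ∷ (12 , 21 , 4) ∷ [])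
  ∷ ((4 , 34 , 2) ∷ (16 , 0 , 48) ∷ (1 , 58 , 50) ∷ (46 , 53 , 32) ∷ (19 , 51 , 33) ∷ (59 , 42 , 66) ∷ (52 , 6 , 30) ∷ (17 , 47 , 57) ∷ (43 , 14 , 35) ∷ (41 , 68 , 63) ∷ (55 , 65 , 44) ∷ (67 , 39 , 45) ∷ (25 , 61 , 9) ∷ (26 , 23 , 27) ∷ (29 , 36 , 60) ∷ (40 , 10 , 21) ∷ (62 , 24 , 54) ∷ (38 , 11 , 15) ∷ (49 , 31 , 8) ∷ (37 , 28 , 20) ∷ (56 , 12 , 18) ∷ (64 , 7 , 3) ∷ (13 , 22 , 5) ∷ [])
  ∷ ((5 , 35 , 0) ∷ (17 , 1 , 49) ∷ (2 , 59 , 48) ∷ (47 , 51 , 30) ∷ (20 , 52 , 34) ∷ (57 , 43 , 67) ∷ (53 , 7 , 31) ∷ (15 , 45 , 58) ∷ (44 , 12 , 33) ∷ (39 , 66 , 64) ∷ (56 , 63 , 42) ∷ (68 , 40 , 46) ∷ (26 , 62 , 10) ∷ (24 , 21 , 28) ∷ (27 , 37 , 61) ∷ (41 , 11 , 22) ∷ (60 , 25 , 55) ∷ (36 , 9 , 16) ∷ (50 , 32 , 6) ∷ (38 , 29 , 18) ∷ (54 , 13 , 19) ∷ (65 , 8 , 4) ∷ (14 , 23 , 3) ∷ [])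
  ∷ ((39 , 15 , 1) ∷ (57 , 2 , 5) ∷ (0 , 51 , 4) ∷ (33 , 43 , 46) ∷ (27 , 44 , 17) ∷ (52 , 65 , 32) ∷ (42 , 11 , 47) ∷ (58 , 34 , 53) ∷ (63 , 19 , 16) ∷ (25 , 31 , 62) ∷ (12 , 61 , 64) ∷ (30 , 26 , 35) ∷ (36 , 21 , 50) ∷ (37 , 67 , 8) ∷ (7 , 56 , 23) ∷ (24 , 48 , 68) ∷ (22 , 38 , 14) ∷ (55 , 49 , 59) ∷ (3 , 45 , 10) ∷ (54 , 6 , 28) ∷ (13 , 20 , 29) ∷ (60 , 9 , 41) ∷ (18 , 66 , 40) ∷ [])
  ∷ ((40 , 16 , 2) ∷ (58 , 0 , 3) ∷ (1 , 52 , 5) ∷ (34 , 44 , 47) ∷ (28 , 42 , 15) ∷ (53 , 63 , 30) ∷ (43 , 9 , 45) ∷ (59 , 35 , 51) ∷ (64 , 20 , 17) ∷ (26 , 32 , 60) ∷ (13 , 62 , 65) ∷ (31 , 24 , 33) ∷ (37 , 22 , 48) ∷ (38 , 68 , 6) ∷ (8 , 54 , 21) ∷ (25 , 49 , 66) ∷ (23 , 36 , 12) ∷ (56 , 50 , 57) ∷ (4 , 46 , 11) ∷ (55 , 7 , 29) ∷ (14 , 18 , 27) ∷ (61 , 10 , 39) ∷ (19 , 67 , 41) ∷ [])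
  ∷ ((41 , 17 , 0) ∷ (59 , 1 , 4) ∷ (2 , 53 , 3) ∷ (35 , 42 , 45) ∷ (29 , 43 , 16) ∷ (51 , 64 , 31) ∷ (44 , 10 , 46) ∷ (57 , 33 , 52) ∷ (65 , 18 , 15) ∷ (24 , 30 , 61) ∷ (14 , 60 , 63) ∷ (32 , 25 , 34) ∷ (38 , 23 , 49) ∷ (36 , 66 , 7) ∷ (6 , 55 , 22) ∷ (26 , 50 , 67) ∷ (21 , 37 , 13) ∷ (54 , 48 , 58) ∷ (5 , 47 , 9) ∷ (56 , 8 , 27) ∷ (12 , 19 , 28) ∷ (62 , 11 , 40) ∷ (20 , 68 , 39) ∷ [])
  ∷ ((6 , 66 , 1) ∷ (30 , 2 , 29) ∷ (0 , 45 , 28) ∷ (21 , 34 , 61) ∷ (36 , 35 , 68) ∷ (46 , 17 , 65) ∷ (33 , 14 , 62) ∷ (31 , 22 , 47) ∷ (15 , 25 , 67) ∷ (10 , 64 , 59) ∷ (39 , 58 , 16) ∷ (63 , 11 , 23) ∷ (48 , 51 , 20) ∷ (49 , 43 , 56) ∷ (55 , 5 , 53) ∷ (9 , 18 , 44) ∷ (52 , 50 , 41) ∷ (4 , 19 , 32) ∷ (27 , 60 , 13) ∷ (3 , 54 , 37) ∷ (40 , 26 , 38) ∷ (57 , 12 , 8) ∷ (24 , 42 , 7) ∷ [])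
  ∷ ((7 , 67 , 2) ∷ (31 , 0 , 27) ∷ (1 , 46 , 29) ∷ (22 , 35 , 62) ∷ (37 , 33 , 66) ∷ (47 , 15 , 63) ∷ (34 , 12 , 60) ∷ (32 , 23 , 45) ∷ (16 , 26 , 68) ∷ (11 , 65 , 57) ∷ (40 , 59 , 17) ∷ (64 , 9 , 21) ∷ (49 , 52 , 18) ∷ (50 , 44 , 54) ∷ (56 , 3 , 51) ∷ (10 , 19 , 42) ∷ (53 , 48 , 39) ∷ (5 , 20 , 30) ∷ (28 , 61 , 14) ∷ (4 , 55 , 38) ∷ (41 , 24 , 36) ∷ (58 , 13 , 6) ∷ (25 , 43 , 8) ∷ [])
  ∷ ((8 , 68 , 0) ∷ (32 , 1 , 28) ∷ (2 , 47 , 27) ∷ (23 , 33 , 60) ∷ (38 , 34 , 67) ∷ (45 , 16 , 64) ∷ (35 , 13 , 61) ∷ (30 , 21 , 46) ∷ (17 , 24 , 66) ∷ (9 , 63 , 58) ∷ (41 , 57 , 15) ∷ (65 , 10 , 22) ∷ (50 , 53 , 19) ∷ (48 , 42 , 55) ∷ (54 , 4 , 52) ∷ (11 , 20 , 43) ∷ (51 , 49 , 40) ∷ (3 , 18 , 31) ∷ (29 , 62 , 12) ∷ (5 , 56 , 36) ∷ (39 , 25 , 37) ∷ (59 , 14 , 7) ∷ (26 , 44 , 6) ∷ [])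
  ∷ ((24 , 57 , 1) ∷ (51 , 2 , 41) ∷ (0 , 42 , 40) ∷ (15 , 64 , 34) ∷ (6 , 65 , 59) ∷ (43 , 62 , 47) ∷ (63 , 50 , 35) ∷ (52 , 16 , 44) ∷ (60 , 28 , 58) ∷ (37 , 46 , 23) ∷ (18 , 22 , 61) ∷ (45 , 38 , 17) ∷ (54 , 66 , 5) ∷ (55 , 31 , 11) ∷ (10 , 14 , 68) ∷ (36 , 3 , 32) ∷ (67 , 56 , 20) ∷ (13 , 4 , 53) ∷ (39 , 33 , 49) ∷ (12 , 9 , 7) ∷ (19 , 29 , 8) ∷ (21 , 48 , 26) ∷ (27 , 30 , 25) ∷ [])
  ∷ ((25 , 58 , 2) ∷ (52 , 0 , 39) ∷ (1 , 43 , 41) ∷ (16 , 65 , 35) ∷ (7 , 63 , 57) ∷ (44 , 60 , 45) ∷ (64 , 48 , 33) ∷ (53 , 17 , 42) ∷ (61 , 29 , 59) ∷ (38 , 47 , 21) ∷ (19 , 23 , 62) ∷ (46 , 36 , 15) ∷ (55 , 67 , 3) ∷ (56 , 32 , 9) ∷ (11 , 12 , 66) ∷ (37 , 4 , 30) ∷ (68 , 54 , 18) ∷ (14 , 5 , 51) ∷ (40 , 34 , 50) ∷ (13 , 10 , 8) ∷ (20 , 27 , 6) ∷ (22 , 49 , 24) ∷ (28 , 31 , 26) ∷ [])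
  ∷ ((26 , 59 , 0) ∷ (53 , 1 , 40) ∷ (2 , 44 , 39) ∷ (17 , 63 , 33) ∷ (8 , 64 , 58) ∷ (42 , 61 , 46) ∷ (65 , 49 , 34) ∷ (51 , 15 , 43) ∷ (62 , 27 , 57) ∷ (36 , 45 , 22) ∷ (20 , 21 , 60) ∷ (47 , 37 , 16) ∷ (56 , 68 , 4) ∷ (54 , 30 , 10) ∷ (9 , 13 , 67) ∷ (38 , 5 , 31) ∷ (66 , 55 , 19) ∷ (12 , 3 , 52) ∷ (41 , 35 , 48) ∷ (14 , 11 , 6) ∷ (18 , 28 , 7) ∷ (23 , 50 , 25) ∷ (29 , 32 , 24) ∷ [])
  ∷ ((9 , 30 , 1) ∷ (45 , 2 , 8) ∷ (0 , 33 , 7) ∷ (66 , 16 , 22) ∷ (54 , 17 , 32) ∷ (34 , 59 , 62) ∷ (15 , 20 , 23) ∷ (46 , 67 , 35) ∷ (57 , 37 , 31) ∷ (49 , 61 , 53) ∷ (24 , 52 , 58) ∷ (60 , 50 , 68) ∷ (3 , 42 , 29) ∷ (4 , 64 , 14) ∷ (13 , 41 , 44) ∷ (48 , 27 , 65) ∷ (43 , 5 , 26) ∷ (40 , 28 , 47) ∷ (6 , 21 , 19) ∷ (39 , 12 , 55) ∷ (25 , 38 , 56) ∷ (51 , 18 , 11) ∷ (36 , 63 , 10) ∷ [])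
  ∷ ((10 , 31 , 2) ∷ (46 , 0 , 6) ∷ (1 , 34 , 8) ∷ (67 , 17 , 23) ∷ (55 , 15 , 30) ∷ (35 , 57 , 60) ∷ (16 , 18 , 21) ∷ (47 , 68 , 33) ∷ (58 , 38 , 32) ∷ (50 , 62 , 51) ∷ (25 , 53 , 59) ∷ (61 , 48 , 66) ∷ (4 , 43 , 27) ∷ (5 , 65 , 12) ∷ (14 , 39 , 42) ∷ (49 , 28 , 63) ∷ (44 , 3 , 24) ∷ (41 , 29 , 45) ∷ (7 , 22 , 20) ∷ (40 , 13 , 56) ∷ (26 , 36 , 54) ∷ (52 , 19 , 9) ∷ (37 , 64 , 11) ∷ [])
  ∷ ((11 , 32 , 0) ∷ (47 , 1 , 7) ∷ (2 , 35 , 6) ∷ (68 , 15 , 21) ∷ (56 , 16 , 31) ∷ (33 , 58 , 61) ∷ (17 , 19 , 22) ∷ (45 , 66 , 34) ∷ (59 , 36 , 30) ∷ (48 , 60 , 52) ∷ (26 , 51 , 57) ∷ (62 , 49 , 67) ∷ (5 , 44 , 28) ∷ (3 , 63 , 13) ∷ (12 , 40 , 43) ∷ (50 , 29 , 64) ∷ (42 , 4 , 25) ∷ (39 , 27 , 46) ∷ (8 , 23 , 18) ∷ (41 , 14 , 54) ∷ (24 , 37 , 55) ∷ (53 , 20 , 10) ∷ (38 , 65 , 9) ∷ [])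
  ∷ ((27 , 21 , 1) ∷ (66 , 2 , 20) ∷ (0 , 30 , 19) ∷ (60 , 46 , 64) ∷ (24 , 47 , 23) ∷ (31 , 35 , 44) ∷ (45 , 56 , 65) ∷ (67 , 61 , 32) ∷ (33 , 40 , 22) ∷ (7 , 43 , 17) ∷ (3 , 16 , 34) ∷ (42 , 8 , 62) ∷ (9 , 57 , 14) ∷ (10 , 52 , 38) ∷ (37 , 50 , 59) ∷ (6 , 12 , 53) ∷ (58 , 11 , 5) ∷ (49 , 13 , 68) ∷ (18 , 63 , 55) ∷ (48 , 36 , 25) ∷ (4 , 41 , 26) ∷ (15 , 54 , 29) ∷ (39 , 51 , 28) ∷ [])
  ∷ ((28 , 22 , 2) ∷ (67 , 0 , 18) ∷ (1 , 31 , 20) ∷ (61 , 47 , 65) ∷ (25 , 45 , 21) ∷ (32 , 33 , 42) ∷ (46 , 54 , 63) ∷ (68 , 62 , 30) ∷ (34 , 41 , 23) ∷ (8 , 44 , 15) ∷ (4 , 17 , 35) ∷ (43 , 6 , 60) ∷ (10 , 58 , 12) ∷ (11 , 53 , 36) ∷ (38 , 48 , 57) ∷ (7 , 13 , 51) ∷ (59 , 9 , 3) ∷ (50 , 14 , 66) ∷ (19 , 64 , 56) ∷ (49 , 37 , 26) ∷ (5 , 39 , 24) ∷ (16 , 55 , 27) ∷ (40 , 52 , 29) ∷ [])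
  ∷ ((29 , 23 , 0) ∷ (68 , 1 , 19) ∷ (2 , 32 , 18) ∷ (62 , 45 , 63) ∷ (26 , 46 , 22) ∷ (30 , 34 , 43) ∷ (47 , 55 , 64) ∷ (66 , 60 , 31) ∷ (35 , 39 , 21) ∷ (6 , 42 , 16) ∷ (5 , 15 , 33) ∷ (44 , 7 , 61) ∷ (11 , 59 , 13) ∷ (9 , 51 , 37) ∷ (36 , 49 , 58) ∷ (8 , 14 , 52) ∷ (57 , 10 , 4) ∷ (48 , 12 , 67) ∷ (20 , 65 , 54) ∷ (50 , 38 , 24) ∷ (3 , 40 , 25) ∷ (17 , 56 , 28) ∷ (41 , 53 , 27) ∷ [])
  ∷ ((12 , 63 , 1) ∷ (60 , 2 , 56) ∷ (0 , 21 , 55) ∷ (42 , 67 , 52) ∷ (3 , 68 , 65) ∷ (22 , 32 , 59) ∷ (66 , 26 , 53) ∷ (61 , 43 , 23) ∷ (30 , 49 , 64) ∷ (19 , 58 , 47) ∷ (9 , 46 , 31) ∷ (57 , 20 , 44) ∷ (27 , 33 , 38) ∷ (28 , 16 , 41) ∷ (40 , 8 , 35) ∷ (18 , 36 , 17) ∷ (34 , 29 , 11) ∷ (7 , 37 , 62) ∷ (54 , 51 , 25) ∷ (6 , 39 , 4) ∷ (10 , 50 , 5) ∷ (45 , 24 , 14) ∷ (48 , 15 , 13) ∷ [])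
  ∷ ((13 , 64 , 2) ∷ (61 , 0 , 54) ∷ (1 , 22 , 56) ∷ (43 , 68 , 53) ∷ (4 , 66 , 63) ∷ (23 , 30 , 57) ∷ (67 , 24 , 51) ∷ (62 , 44 , 21) ∷ (31 , 50 , 65) ∷ (20 , 59 , 45) ∷ (10 , 47 , 32) ∷ (58 , 18 , 42) ∷ (28 , 34 , 36) ∷ (29 , 17 , 39) ∷ (41 , 6 , 33) ∷ (19 , 37 , 15) ∷ (35 , 27 , 9) ∷ (8 , 38 , 60) ∷ (55 , 52 , 26) ∷ (7 , 40 , 5) ∷ (11 , 48 , 3) ∷ (46 , 25 , 12) ∷ (49 , 16 , 14) ∷ [])
  ∷ ((14 , 65 , 0) ∷ (62 , 1 , 55) ∷ (2 , 23 , 54) ∷ (44 , 66 , 51) ∷ (5 , 67 , 64) ∷ (21 , 31 , 58) ∷ (68 , 25 , 52) ∷ (60 , 42 , 22) ∷ (32 , 48 , 63) ∷ (18 , 57 , 46) ∷ (11 , 45 , 30) ∷ (59 , 19 , 43) ∷ (29 , 35 , 37) ∷ (27 , 15 , 40) ∷ (39 , 7 , 34) ∷ (20 , 38 , 16) ∷ (33 , 28 , 10) ∷ (6 , 36 , 61) ∷ (56 , 53 , 24) ∷ (8 , 41 , 3) ∷ (9 , 49 , 4) ∷ (47 , 26 , 13) ∷ (50 , 17 , 12) ∷ [])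
  ∷ ((48 , 45 , 1) ∷ (33 , 2 , 11) ∷ (0 , 15 , 10) ∷ (30 , 58 , 67) ∷ (12 , 59 , 47) ∷ (16 , 53 , 23) ∷ (57 , 29 , 68) ∷ (34 , 31 , 17) ∷ (51 , 55 , 46) ∷ (4 , 22 , 44) ∷ (36 , 43 , 52) ∷ (21 , 5 , 32) ∷ (39 , 63 , 8) ∷ (40 , 61 , 20) ∷ (19 , 26 , 65) ∷ (3 , 6 , 62) ∷ (64 , 41 , 38) ∷ (25 , 7 , 35) ∷ (9 , 66 , 28) ∷ (24 , 18 , 13) ∷ (37 , 56 , 14) ∷ (42 , 27 , 50) ∷ (54 , 60 , 49) ∷ [])
  ∷ ((49 , 46 , 2) ∷ (34 , 0 , 9) ∷ (1 , 16 , 11) ∷ (31 , 59 , 68) ∷ (13 , 57 , 45) ∷ (17 , 51 , 21) ∷ (58 , 27 , 66) ∷ (35 , 32 , 15) ∷ (52 , 56 , 47) ∷ (5 , 23 , 42) ∷ (37 , 44 , 53) ∷ (22 , 3 , 30) ∷ (40 , 64 , 6) ∷ (41 , 62 , 18) ∷ (20 , 24 , 63) ∷ (4 , 7 , 60) ∷ (65 , 39 , 36) ∷ (26 , 8 , 33) ∷ (10 , 67 , 29) ∷ (25 , 19 , 14) ∷ (38 , 54 , 12) ∷ (43 , 28 , 48) ∷ (55 , 61 , 50) ∷ [])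
  ∷ ((50 , 47 , 0) ∷ (35 , 1 , 10) ∷ (2 , 17 , 9) ∷ (32 , 57 , 66) ∷ (14 , 58 , 46) ∷ (15 , 52 , 22) ∷ (59 , 28 , 67) ∷ (33 , 30 , 16) ∷ (53 , 54 , 45) ∷ (3 , 21 , 43) ∷ (38 , 42 , 51) ∷ (23 , 4 , 31) ∷ (41 , 65 , 7) ∷ (39 , 60 , 19) ∷ (18 , 25 , 64) ∷ (5 , 8 , 61) ∷ (63 , 40 , 37) ∷ (24 , 6 , 34) ∷ (11 , 68 , 27) ∷ (26 , 20 , 12) ∷ (36 , 55 , 13) ∷ (44 , 29 , 49) ∷ (56 , 62 , 48) ∷ [])
  ∷ []

rainbowKTSs : All (λ v → ∃[ K ] IsRainbowKTS {v} K) (3 ∷ 9 ∷ 15 ∷ 21 ∷ 33 ∷ 39 ∷ 57 ∷ 69 ∷ [])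
rainbowKTSs =
    rainbowKTS (kirkman (map (map fromTripleℕ) resolution3) refl refl) residue refl
  ∷ rainbowKTS (kirkman (map (map fromTripleℕ) resolution9) refl refl) residue refl
  ∷ rainbowKTS (kirkman (map (map fromTripleℕ) resolution15) refl refl) residue refl
  ∷ rainbowKTS (kirkman (map (map fromTripleℕ) resolution21) refl refl) residue refl
  ∷ rainbowKTS (kirkman (map (map fromTripleℕ) resolution33) refl refl) residue refl
  ∷ rainbowKTS (kirkman (map (map fromTripleℕ) resolution39) refl refl) residue refl
  ∷ rainbowKTS (kirkman (map (map fromTripleℕ) resolution57) refl refl) residue refl
  ∷ rainbowKTS (kirkman (map (map fromTripleℕ) resolution69) refl refl) residue refl
  ∷ []

lemma2p2 : ∀ (v : ℕ) → v ∈ (3 ∷ 9 ∷ 15 ∷ 21 ∷ 33 ∷ 39 ∷ 57 ∷ 69 ∷ []) →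
    ∃[ K ] IsRainbowKTS {v} K
lemma2p2 _ = All.lookup rainbowKTSs
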